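{- For all integers $n,s\geq 1$ the following identities hold in $\mathbb{Q}[t]$: \begin{align*} (t-4)\sum_{k=1}^n \frac{t^{k-1}}{\binom{2k}{k}}+ 2\sum_{k=1}^n \frac{t^{k-1}}{k\binom{2k}{k}} &= \frac{t^n}{\binom{2n}{n}}-1,\\ (t-4)\sum_{k=1}^n \frac{t^{k-1}H_{k-1}(s)}{\binom{2k}{k}}+ 2\sum_{k=1}^n \frac{t^{k-1}H_{k-1}(s)}{k\binom{2k}{k}} &= \frac{t^nH_n(s)}{\binom{2n}{n}}-\sum_{k=1}^n \frac{t^{k}}{k^s\binom{2k}{k}}. \end{align*}
   Context: For integers $k\ge 0$ and $s\ge 1$, $H_k(s)=\sum_{r=1}^k 1/r^s$ (so $H_0(s)=0$). -}

module Defs where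

open import Data.Nat as ℕ using (ℕ; zero; suc)
open import Data.Nat.Combinatorics using (_C_)
open import Data.Integer using (+_)
open import Data.Rational using (ℚ; _+_; _*_; _/_; 0ℚ; 1ℚ)

ι : ℕ → ℚ
ι n = (+ n) / 1

-- 1/n as a rational; only ever applied to positive n below (convention 1/0 := 0 never used)
inv : ℕ → ℚ
inv zero    = 0ℚ
inv (suc n) = (+ 1) / suc n

pow : ℚ → ℕ → ℚ
pow t zero    = 1ℚ
pow t (suc m) = t * pow t m

sum1 : ℕ → (ℕ → ℚ) → ℚ
sum1 zero    f = 0ℚ
sum1 (suc n) f = sum1 n f + f (suc n)

cbin : ℕ → ℕ
cbin k = (2 ℕ.* k) C k

H : ℕ → ℕ → ℚ
H k s = sum1 k (λ r → inv (r ℕ.^ s))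

{-# OPTIONS --safe #-}
-- Both identities telescope. The recurrence k·C(2k,k) = 2(2k−1)·C(2k−2,k−1) says
-- 4/C(2k,k) − 2/(k·C(2k,k)) = 1/C(2k−2,k−1), so for any weight x the k-th summand on the left,
-- (t − 4)·x/C(2k,k) + 2·x/(k·C(2k,k)), equals t·x/C(2k,k) − x/C(2k−2,k−1).  With x = t^(k−1)
-- resp. t^(k−1)·H_(k−1)(s) this is F(k) − F(k−1) for the right-hand side F, so the sums
-- collapse to F(n) − F(0).
module Submission where

open import Defs
open import Data.Product using (_×_; _,_)
open import Data.Nat as ℕ using (ℕ; _≥_; _∸_; zero; suc; _!; NonZero)
import Data.Nat.Properties as ℕ
open import Data.Nat.Properties using (_!≢0; _!*_!≢0)
open import Data.Nat.Combinatorics using (_C_; k![n∸k]!∣n!)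
open import Data.Nat.Combinatorics.Specification using (nCk≡n!/k![n-k]!)
open import Data.Nat.DivMod using (m/n*n≡m)
import Data.Nat.Tactic.RingSolver as ℕ-Solver
open import Data.Integer as ℤ using (+_)
import Data.Integer.Properties as ℤ
import Data.Integer.Tactic.RingSolver as ℤ-Solver
open import Data.Rational using (ℚ; _+_; _*_; _-_; 0ℚ; 1ℚ; fromℚᵘ; toℚᵘ)
open import Data.Rational.Properties
  using (+-*-commutativeRing; _≟_; toℚᵘ-injective; toℚᵘ-fromℚᵘ; toℚᵘ-homo-*; toℚᵘ-homo-+;
         fromℚᵘ-cong; *-identityˡ; *-zeroʳ; +-inverseʳ; *-assoc; +-identityʳ)
import Data.Rational.Unnormalised as ℚᵘ
import Data.Rational.Unnormalised.Properties as ℚᵘ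
open import Relation.Binary.PropositionalEquality
open import Relation.Nullary.Decidable using (dec⇒maybe)
open import Tactic.RingSolver using (solve-∀)
import Tactic.RingSolver.Core.AlmostCommutativeRing as ACR

ℚ-ring : ACR.AlmostCommutativeRing _ _
ℚ-ring = ACR.fromCommutativeRing +-*-commutativeRing (λ x → dec⇒maybe (0ℚ ≟ x))

fromℚᵘ-homo-+ : ∀ p q → fromℚᵘ (p ℚᵘ.+ q) ≡ fromℚᵘ p + fromℚᵘ q
fromℚᵘ-homo-+ p q = toℚᵘ-injective (begin
  toℚᵘ (fromℚᵘ (p ℚᵘ.+ q))              ≈⟨ toℚᵘ-fromℚᵘ (p ℚᵘ.+ q) ⟩
  p ℚᵘ.+ q                              ≈⟨ ℚᵘ.+-cong (toℚᵘ-fromℚᵘ p) (toℚᵘ-fromℚᵘ q) ⟨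
  toℚᵘ (fromℚᵘ p) ℚᵘ.+ toℚᵘ (fromℚᵘ q)  ≈⟨ toℚᵘ-homo-+ (fromℚᵘ p) (fromℚᵘ q) ⟨
  toℚᵘ (fromℚᵘ p + fromℚᵘ q)            ∎)
  where open ℚᵘ.≃-Reasoning

fromℚᵘ-homo-* : ∀ p q → fromℚᵘ (p ℚᵘ.* q) ≡ fromℚᵘ p * fromℚᵘ q
fromℚᵘ-homo-* p q = toℚᵘ-injective (begin
  toℚᵘ (fromℚᵘ (p ℚᵘ.* q))              ≈⟨ toℚᵘ-fromℚᵘ (p ℚᵘ.* q) ⟩
  p ℚᵘ.* q                              ≈⟨ ℚᵘ.*-cong (toℚᵘ-fromℚᵘ p) (toℚᵘ-fromℚᵘ q) ⟨
  toℚᵘ (fromℚᵘ p) ℚᵘ.* toℚᵘ (fromℚᵘ q)  ≈⟨ toℚᵘ-homo-* (fromℚᵘ p) (fromℚᵘ q) ⟨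
  toℚᵘ (fromℚᵘ p * fromℚᵘ q)            ∎)
  where open ℚᵘ.≃-Reasoning

-- ι n and inv (suc n) are definitionally fromℚᵘ (ιᵘ n) and fromℚᵘ (1/1+ n).
ιᵘ : ℕ → ℚᵘ.ℚᵘ
ιᵘ n = ℚᵘ.mkℚᵘ (+ n) 0

1/1+ : ℕ → ℚᵘ.ℚᵘ
1/1+ n = ℚᵘ.mkℚᵘ (+ 1) n

ι-homo-+ : ∀ m n → ι (m ℕ.+ n) ≡ ι m + ι n
ι-homo-+ m n = trans (fromℚᵘ-cong {ιᵘ (m ℕ.+ n)} {ιᵘ m ℚᵘ.+ ιᵘ n} (ℚᵘ.*≡* cross)) (fromℚᵘ-homo-+ (ιᵘ m) (ιᵘ n))
  where
  unit-factors : ∀ x y → (x ℤ.+ y) ℤ.* ℤ.1ℤ ≡ (x ℤ.* ℤ.1ℤ ℤ.+ y ℤ.* ℤ.1ℤ) ℤ.* ℤ.1ℤ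
  unit-factors = ℤ-Solver.solve-∀
  cross : + (m ℕ.+ n) ℤ.* ℤ.1ℤ ≡ (+ m ℤ.* ℤ.1ℤ ℤ.+ + n ℤ.* ℤ.1ℤ) ℤ.* ℤ.1ℤ
  cross = trans (cong (ℤ._* ℤ.1ℤ) (ℤ.pos-+ m n)) (unit-factors (+ m) (+ n))

ι-homo-* : ∀ m n → ι (m ℕ.* n) ≡ ι m * ι n
ι-homo-* m n = trans (fromℚᵘ-cong {ιᵘ (m ℕ.* n)} {ιᵘ m ℚᵘ.* ιᵘ n} (ℚᵘ.*≡* cross)) (fromℚᵘ-homo-* (ιᵘ m) (ιᵘ n))
  where
  cross : + (m ℕ.* n) ℤ.* ℤ.1ℤ ≡ + m ℤ.* + n ℤ.* ℤ.1ℤ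
  cross = cong (ℤ._* ℤ.1ℤ) (ℤ.pos-* m n)

inv-homo-* : ∀ m n .{{_ : NonZero m}} .{{_ : NonZero n}} → inv (m ℕ.* n) ≡ inv m * inv n
inv-homo-* (suc m) (suc n) =
  trans (fromℚᵘ-cong {1/1+ (n ℕ.+ m ℕ.* suc n)} {1/1+ m ℚᵘ.* 1/1+ n} (ℚᵘ.*≡* refl))
        (fromℚᵘ-homo-* (1/1+ m) (1/1+ n))

ι*inv≡1 : ∀ n .{{_ : NonZero n}} → ι n * inv n ≡ 1ℚ
ι*inv≡1 n@(suc n-1) =
  trans (sym (fromℚᵘ-homo-* (ιᵘ n) (1/1+ n-1)))
        (fromℚᵘ-cong {ιᵘ n ℚᵘ.* 1/1+ n-1} {ιᵘ 1} (ℚᵘ.*≡* (cross (+ n))))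
  where
  cross : ∀ x → x ℤ.* ℤ.1ℤ ℤ.* ℤ.1ℤ ≡ ℤ.1ℤ ℤ.* (ℤ.1ℤ ℤ.* x)
  cross = ℤ-Solver.solve-∀

inv≡ι*inv[*] : ∀ m n .{{_ : NonZero m}} .{{_ : NonZero n}} → inv n ≡ ι m * inv (m ℕ.* n)
inv≡ι*inv[*] m n = begin
  inv n                    ≡⟨ *-identityˡ (inv n) ⟨
  1ℚ * inv n               ≡⟨ cong (_* inv n) (ι*inv≡1 m) ⟨
  ι m * inv m * inv n      ≡⟨ *-assoc (ι m) (inv m) (inv n) ⟩
  ι m * (inv m * inv n)    ≡⟨ cong (ι m *_) (inv-homo-* m n) ⟨
  ι m * inv (m ℕ.* n)      ∎
  where open ≡-Reasoning

nCk*k!*[n∸k]!≡n! : ∀ {n k} → k ℕ.≤ n → (n C k) ℕ.* (k ! ℕ.* (n ∸ k) !) ≡ n !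
nCk*k!*[n∸k]!≡n! {n} {k} k≤n = trans (cong (ℕ._* (k ! ℕ.* (n ∸ k) !)) (nCk≡n!/k![n-k]! k≤n))
  (m/n*n≡m {{k !* (n ∸ k) !≢0}} (k![n∸k]!∣n! k≤n))

cbin*k!*k!≡[2k]! : ∀ k → cbin k ℕ.* (k ! ℕ.* k !) ≡ (2 ℕ.* k) !
cbin*k!*k!≡[2k]! k = begin
  cbin k ℕ.* (k ! ℕ.* k !)             ≡⟨ cong (λ j → cbin k ℕ.* (k ! ℕ.* j !)) 2k∸k≡k ⟨
  cbin k ℕ.* (k ! ℕ.* (2 ℕ.* k ∸ k) !) ≡⟨ nCk*k!*[n∸k]!≡n! (ℕ.m≤m+n k (k ℕ.+ 0)) ⟩
  (2 ℕ.* k) !                          ∎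
  where
  open ≡-Reasoning
  2k∸k≡k : 2 ℕ.* k ∸ k ≡ k
  2k∸k≡k = trans (ℕ.m+n∸m≡n k (k ℕ.+ 0)) (ℕ.+-identityʳ k)

cbin-nonZero : ∀ k → NonZero (cbin k)
cbin-nonZero k = ℕ.m*n≢0⇒m≢0 (cbin k) {{subst NonZero (sym (cbin*k!*k!≡[2k]! k)) ((2 ℕ.* k) !≢0)}}

suc*cbin-suc : ∀ k → suc k ℕ.* cbin (suc k) ≡ 2 ℕ.* (1 ℕ.+ 2 ℕ.* k) ℕ.* cbin k
suc*cbin-suc k = ℕ.*-cancelʳ-≡ _ _ (suc k ℕ.* (k ! ℕ.* k !)) {{ℕ.m*n≢0 (suc k) _ {{_}} {{k !* k !≢0}}}} (begin
  suc k ℕ.* cbin (suc k) ℕ.* (suc k ℕ.* (k ! ℕ.* k !))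
    ≡⟨ regroup₁ k (cbin (suc k)) (k !) ⟩
  cbin (suc k) ℕ.* (suc k ! ℕ.* suc k !)
    ≡⟨ cbin*k!*k!≡[2k]! (suc k) ⟩
  (2 ℕ.* suc k) !
    ≡⟨ cong _! (ℕ.*-suc 2 k) ⟩
  (2 ℕ.+ 2 ℕ.* k) ℕ.* ((1 ℕ.+ 2 ℕ.* k) ℕ.* (2 ℕ.* k) !)
    ≡⟨ cong (λ j → (2 ℕ.+ 2 ℕ.* k) ℕ.* ((1 ℕ.+ 2 ℕ.* k) ℕ.* j)) (cbin*k!*k!≡[2k]! k) ⟨
  (2 ℕ.+ 2 ℕ.* k) ℕ.* ((1 ℕ.+ 2 ℕ.* k) ℕ.* (cbin k ℕ.* (k ! ℕ.* k !)))
    ≡⟨ regroup₂ k (cbin k) (k !) ⟩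
  2 ℕ.* (1 ℕ.+ 2 ℕ.* k) ℕ.* cbin k ℕ.* (suc k ℕ.* (k ! ℕ.* k !)) ∎)
  where
  open ≡-Reasoning
  regroup₁ : ∀ k c f → suc k ℕ.* c ℕ.* (suc k ℕ.* (f ℕ.* f)) ≡ c ℕ.* (suc k ℕ.* f ℕ.* (suc k ℕ.* f))
  regroup₁ = ℕ-Solver.solve-∀
  regroup₂ : ∀ k c f → (2 ℕ.+ 2 ℕ.* k) ℕ.* ((1 ℕ.+ 2 ℕ.* k) ℕ.* (c ℕ.* (f ℕ.* f)))
                     ≡ 2 ℕ.* (1 ℕ.+ 2 ℕ.* k) ℕ.* c ℕ.* (suc k ℕ.* (f ℕ.* f))
  regroup₂ = ℕ-Solver.solve-∀

inv-cbin-recurrence : ∀ k → ι 4 * inv (cbin (suc k)) - ι 2 * inv (suc k ℕ.* cbin (suc k)) ≡ inv (cbin k)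
inv-cbin-recurrence k = begin
  ι 4 * inv c₁ - ι 2 * w
    ≡⟨ cong (λ x → ι 4 * x - ι 2 * w) (inv≡ι*inv[*] (suc k) c₁ {{_}} {{cbin-nonZero (suc k)}}) ⟩
  ι 4 * (ι (suc k) * w) - ι 2 * w     ≡⟨ factor (ι 4) (ι (suc k)) (ι 2) w ⟩
  (ι 4 * ι (suc k) - ι 2) * w         ≡⟨ cong (λ x → (x - ι 2) * w) 4[1+k]≡2[1+2k]+2 ⟩
  (ι j + ι 2 - ι 2) * w               ≡⟨ cancel (ι j) (ι 2) w ⟩
  ι j * w                             ≡⟨ cong (λ x → ι j * inv x) (suc*cbin-suc k) ⟩
  ι j * inv (j ℕ.* cbin k)            ≡⟨ inv≡ι*inv[*] j (cbin k) {{_}} {{cbin-nonZero k}} ⟨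
  inv (cbin k)                        ∎
  where
  open ≡-Reasoning
  c₁ = cbin (suc k)
  w = inv (suc k ℕ.* c₁)
  j = 2 ℕ.* (1 ℕ.+ 2 ℕ.* k)
  4[1+k]≡2[1+2k]+2 : ι 4 * ι (suc k) ≡ ι j + ι 2
  4[1+k]≡2[1+2k]+2 = begin
    ι 4 * ι (suc k)     ≡⟨ ι-homo-* 4 (suc k) ⟨
    ι (4 ℕ.* suc k)     ≡⟨ cong ι (nat-identity k) ⟩
    ι (j ℕ.+ 2)         ≡⟨ ι-homo-+ j 2 ⟩
    ι j + ι 2           ∎
    where
    nat-identity : ∀ k → 4 ℕ.* suc k ≡ 2 ℕ.* (1 ℕ.+ 2 ℕ.* k) ℕ.+ 2
    nat-identity = ℕ-Solver.solve-∀
  factor : ∀ a b c x → a * (b * x) - c * x ≡ (a * b - c) * x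
  factor = solve-∀ ℚ-ring
  cancel : ∀ a b x → (a + b - b) * x ≡ a * x
  cancel = solve-∀ ℚ-ring

summand-telescopes : ∀ t x k →
  (t - ι 4) * (x * inv (cbin (suc k))) + ι 2 * (x * inv (suc k ℕ.* cbin (suc k)))
    ≡ t * x * inv (cbin (suc k)) - x * inv (cbin k)
summand-telescopes t x k = begin
  (t - ι 4) * (x * c₁) + ι 2 * (x * w)   ≡⟨ regroup t x c₁ w ⟩
  t * x * c₁ - x * (ι 4 * c₁ - ι 2 * w)  ≡⟨ cong (λ y → t * x * c₁ - x * y) (inv-cbin-recurrence k) ⟩
  t * x * c₁ - x * inv (cbin k)          ∎
  where
  open ≡-Reasoning
  c₁ = inv (cbin (suc k))
  w = inv (suc k ℕ.* cbin (suc k))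
  regroup : ∀ t x c w → (t - ι 4) * (x * c) + ι 2 * (x * w) ≡ t * x * c - x * (ι 4 * c - ι 2 * w)
  regroup = solve-∀ ℚ-ring

sum1-linear : ∀ u v f g n → u * sum1 n f + v * sum1 n g ≡ sum1 n (λ k → u * f k + v * g k)
sum1-linear u v f g zero = trans (cong₂ _+_ (*-zeroʳ u) (*-zeroʳ v)) (+-identityʳ 0ℚ)
sum1-linear u v f g (suc n) = begin
  u * (sum1 n f + f (suc n)) + v * (sum1 n g + g (suc n))
    ≡⟨ interchange u v (sum1 n f) (f (suc n)) (sum1 n g) (g (suc n)) ⟩
  (u * sum1 n f + v * sum1 n g) + (u * f (suc n) + v * g (suc n))
    ≡⟨ cong (_+ (u * f (suc n) + v * g (suc n))) (sum1-linear u v f g n) ⟩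
  sum1 n (λ k → u * f k + v * g k) + (u * f (suc n) + v * g (suc n)) ∎
  where
  open ≡-Reasoning
  interchange : ∀ u v a b c d → u * (a + b) + v * (c + d) ≡ (u * a + v * c) + (u * b + v * d)
  interchange = solve-∀ ℚ-ring

sum1-telescope : ∀ (F f : ℕ → ℚ) → (∀ k → f (suc k) ≡ F (suc k) - F k) → ∀ n → sum1 n f ≡ F n - F 0
sum1-telescope F f step zero = sym (+-inverseʳ (F 0))
sum1-telescope F f step (suc n) = begin
  sum1 n f + f (suc n)                ≡⟨ cong₂ _+_ (sum1-telescope F f step n) (step n) ⟩
  (F n - F 0) + (F (suc n) - F n)     ≡⟨ collapse (F 0) (F n) (F (suc n)) ⟩
  F (suc n) - F 0                     ∎
  where
  open ≡-Reasoning
  collapse : ∀ a b c → (b - a) + (c - b) ≡ c - a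
  collapse = solve-∀ ℚ-ring

telescoping-identity : ∀ t (x F : ℕ → ℚ) →
  (∀ k → t * x k * inv (cbin (suc k)) - x k * inv (cbin k) ≡ F (suc k) - F k) → ∀ n →
  (t - ι 4) * sum1 n (λ k → x (k ∸ 1) * inv (cbin k))
    + ι 2 * sum1 n (λ k → x (k ∸ 1) * inv (k ℕ.* cbin k))
    ≡ F n - F 0
telescoping-identity t x F step n = begin
  (t - ι 4) * sum1 n f + ι 2 * sum1 n g         ≡⟨ sum1-linear (t - ι 4) (ι 2) f g n ⟩
  sum1 n (λ k → (t - ι 4) * f k + ι 2 * g k)   ≡⟨ sum1-telescope F _ (λ k → trans (summand-telescopes t (x k) k) (step k)) n ⟩
  F n - F 0                                      ∎
  where
  open ≡-Reasoning
  f g : ℕ → ℚ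
  f k = x (k ∸ 1) * inv (cbin k)
  g k = x (k ∸ 1) * inv (k ℕ.* cbin k)

harmonic-closedForm : ℚ → ℕ → ℕ → ℚ
harmonic-closedForm t s n = pow t n * H n s * inv (cbin n) - sum1 n (λ k → pow t k * inv (k ℕ.^ s ℕ.* cbin k))

harmonic-closedForm-step : ∀ t s k →
  t * (pow t k * H k s) * inv (cbin (suc k)) - pow t k * H k s * inv (cbin k)
    ≡ harmonic-closedForm t s (suc k) - harmonic-closedForm t s k
harmonic-closedForm-step t s k = begin
  t * (P * h) * c₁ - P * h * c₀
    ≡⟨ regroup t P h e c₁ c₀ S ⟩
  (t * P * (h + e) * c₁ - (S + t * P * (e * c₁))) - (P * h * c₀ - S)
    ≡⟨ cong (λ y → (t * P * (h + e) * c₁ - (S + t * P * y)) - (P * h * c₀ - S))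
            (inv-homo-* (suc k ℕ.^ s) (cbin (suc k)) {{ℕ.m^n≢0 (suc k) s}} {{cbin-nonZero (suc k)}}) ⟨
  harmonic-closedForm t s (suc k) - harmonic-closedForm t s k
    ∎
  where
  open ≡-Reasoning
  P = pow t k
  h = H k s
  e = inv (suc k ℕ.^ s)
  c₀ = inv (cbin k)
  c₁ = inv (cbin (suc k))
  S = sum1 k (λ j → pow t j * inv (j ℕ.^ s ℕ.* cbin j))
  regroup : ∀ t P h e c₁ c₀ S →
    t * (P * h) * c₁ - P * h * c₀ ≡ (t * P * (h + e) * c₁ - (S + t * P * (e * c₁))) - (P * h * c₀ - S)
  regroup = solve-∀ ℚ-ring

theorem5p3 : (n s : ℕ) → n ≥ 1 → s ≥ 1 → (t : ℚ) →
    ((t - ι 4) * sum1 n (λ k → pow t (k ∸ 1) * inv (cbin k))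
      + ι 2 * sum1 n (λ k → pow t (k ∸ 1) * inv (k ℕ.* cbin k))
      ≡ pow t n * inv (cbin n) - ι 1)
    ×
    ((t - ι 4) * sum1 n (λ k → pow t (k ∸ 1) * H (k ∸ 1) s * inv (cbin k))
      + ι 2 * sum1 n (λ k → pow t (k ∸ 1) * H (k ∸ 1) s * inv (k ℕ.* cbin k))
      ≡ pow t n * H n s * inv (cbin n) - sum1 n (λ k → pow t k * inv (k ℕ.^ s ℕ.* cbin k)))
theorem5p3 n s _ _ t =
    telescoping-identity t (pow t) (λ k → pow t k * inv (cbin k)) (λ _ → refl) n
  , trans (telescoping-identity t (λ k → pow t k * H k s) (harmonic-closedForm t s) (harmonic-closedForm-step t s) n)
          (+-identityʳ (harmonic-closedForm t s n))
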